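{- Let $f\colon\{0,1\}^n\to\{0,1,\perp\}$ be a partial function, $F(x,y)=f(x\oplus y)$, and let $h\colon\{0,1\}^n\to\{0,1\}^t$, $\varphi\colon\{0,1\}^t\times\{0,1\}^n\to\{0,1\}$ be total functions with $\varphi(h(x),y)=F(x,y)$ for all $(x,y)\in\operatorname{Dom}(F)$. Suppose $L$ is an $(n-t)$-dimensional linear subspace of $\mathbb F_2^n$ such that for every coset $C$ of $L$, the subgraph of the partial $h$-induced graph induced on the vertices lying in $C$ is connected. Then $\mathrm{NADT^{\oplus}}(f)\le t$.
   Context: $\{0,1\}^n$ is identified with $\mathbb F_2^n$, $\oplus$ is bitwise XOR; $\operatorname{Dom}(f)=f^{ -1}(\{0,1\})$, $\operatorname{Dom}(F)=\{(x,y):x\oplus y\in\operatorname{Dom}(f)\}$. A vector $\Delta$ is a good shift for $h$ if there exist $x,y$ with $x\oplus y=\Delta$ and $h(x)=h(y)$. The total $h$-induced graph has vertex set $\{0,1\}^n$ and an edge between distinct $x,y$ iff $x\oplus y$ is a good shift; the partial $h$-induced graph is its induced subgraph on $\operatorname{Dom}(f)$. With $\langle s,x\rangle=\bigoplus_is_i\wedge x_i$, $\mathrm{NADT^{\oplus}}(f)$ is the minimum $p$ such that there are $s_1,\dots,s_p\in\{0,1\}^n$ and total $l\colon\{0,1\}^p\to\{0,1\}$ with $l(\langle s_1,x\rangle,\dots,\langle s_p,x\rangle)=f(x)$ for all $x\in\operatorname{Dom}(f)$. -}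

module Defs where

open import Data.Nat using (ℕ; _≤_; _∸_)
open import Data.Bool using (Bool; true; false; _xor_; _∧_)
open import Data.Maybe using (Maybe; just; nothing)
open import Data.Vec using (Vec; []; _∷_; zipWith; replicate; map; foldr)
open import Data.Product using (Σ; ∃; _×_; _,_)
open import Relation.Binary.PropositionalEquality using (_≡_; _≢_)
open import Relation.Binary.Construct.Closure.ReflexiveTransitive using (Star)

BitVec : ℕ → Set
BitVec n = Vec Bool n

_⊕_ : ∀ {n} → BitVec n → BitVec n → BitVec n
_⊕_ = zipWith _xor_

zeroV : ∀ {n} → BitVec n
zeroV = replicate _ false

⟨_,_⟩ : ∀ {n} → BitVec n → BitVec n → Bool
⟨ s , x ⟩ = foldr _ _xor_ false (zipWith _∧_ s x)

-- partial function {0,1}^n → {0,1,⊥}; nothing = ⊥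
Partial : ℕ → Set
Partial n = BitVec n → Maybe Bool

InDom : ∀ {n} → Partial n → BitVec n → Set
InDom f x = Σ Bool λ b → f x ≡ just b

lincomb : ∀ {n k} → Vec Bool k → Vec (BitVec n) k → BitVec n
lincomb [] [] = zeroV
lincomb (c ∷ cs) (b ∷ bs) = zipWith _xor_ (map (c ∧_) b) (lincomb cs bs)

LinIndep : ∀ {n k} → Vec (BitVec n) k → Set
LinIndep {k = k} bs = (c : Vec Bool k) → lincomb c bs ≡ zeroV → c ≡ replicate k false

record Subspace (n d : ℕ) : Set where
  field
    basis : Vec (BitVec n) d
    indep : LinIndep basis

_∈L_ : ∀ {n d} → BitVec n → Subspace n d → Set
_∈L_ {d = d} v L = Σ (Vec Bool d) λ c → lincomb c (Subspace.basis L) ≡ v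

InCoset : ∀ {n d} → Subspace n d → BitVec n → BitVec n → Set
InCoset L a x = (a ⊕ x) ∈L L

GoodShift : ∀ {n t} → (BitVec n → BitVec t) → BitVec n → Set
GoodShift h Δ = ∃ λ x → ∃ λ y → (x ⊕ y ≡ Δ) × (h x ≡ h y)

CosetVertex : ∀ {n d} → Partial n → Subspace n d → BitVec n → BitVec n → Set
CosetVertex f L a x = InDom f x × InCoset L a x

-- edges of the subgraph of the partial h-induced graph induced on (a ⊕ L) ∩ Dom(f)
CosetEdge : ∀ {n t d} → Partial n → (BitVec n → BitVec t) → Subspace n d
          → BitVec n → BitVec n → BitVec n → Set
CosetEdge {t = t} f h L a x y =
  (x ≢ y) × GoodShift h (x ⊕ y) × CosetVertex f L a x × CosetVertex f L a y

CosetConnected : ∀ {n t d} → Partial n → (BitVec n → BitVec t) → Subspace n d → BitVec n → Set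
CosetConnected {t = t} f h L a =
  ∀ x y → CosetVertex f L a x → CosetVertex f L a y
        → Star (CosetEdge f h L a) x y

-- NADT⊕(f) ≤ t : the minimum p admitting a representation is ≤ t, i.e. some p ≤ t admits one
NADT⊕≤ : ∀ {n} → Partial n → ℕ → Set
NADT⊕≤ {n} f t =
  Σ ℕ λ p → (p ≤ t) × Σ (Vec (BitVec n) p) λ ss → Σ (BitVec p → Bool) λ l →
    ∀ x b → f x ≡ just b → l (map (λ s → ⟨ s , x ⟩) ss) ≡ b

-- On each coset of L the defined values of f are joined by edges of the partial h-induced
-- graph, and across an edge u — v with u ⊕ v = x₀ ⊕ y₀, h x₀ ≡ h y₀ the relation
-- φ (h x₀) (x₀ ⊕ u) = f u, φ (h y₀) (x₀ ⊕ u) = f v forces f u ≡ f v.  So f is constant on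
-- Dom f ∩ (a ⊕ L) for every coset.  Since dim L = n ∸ t, Gaussian elimination produces
-- p ≤ t parities s₁ … sₚ whose common kernel lies in L; equal parities put two points in
-- one coset, so f factors through x ↦ (⟨ s₁ , x ⟩ , … , ⟨ sₚ , x ⟩).
module Submission where

open import Defs
open import Algebra.Bundles using (CommutativeRing)
open import Data.Nat using (ℕ; _∸_; zero; suc; _+_; _≤_)
open import Data.Nat.Properties using (+-cancelʳ-≤; m≤n+m∸n; ≤-trans; ≤-reflexive; +-identityʳ; +-suc)
open import Data.Bool using (Bool; true; false; _xor_; _∧_)
open import Data.Bool.Properties
  using (xor-assoc; xor-comm; xor-same; xor-identityʳ; ∧-comm; ∧-zeroʳ;
         ∧-distribˡ-xor; xor-∧-commutativeRing)
  renaming (_≟_ to _≟ᵇ_)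
open import Data.Fin.Subset.Properties using (anySubset?)
open import Data.Maybe using (just; nothing)
open import Data.Maybe.Properties using (just-injective)
open import Data.List as List using (List; []; _∷_; length)
open import Data.List.Properties using (length-map)
open import Data.List.Relation.Unary.All as All using (All; []; _∷_)
open import Data.List.Relation.Unary.All.Properties using (map⁻)
open import Data.Vec as Vec using (Vec; []; _∷_; replicate; map; fromList)
open import Data.Vec.Properties using (≡-dec; ∷-injective; zipWith-assoc; zipWith-comm)
open import Data.Product using (Σ; _×_; _,_; proj₁; proj₂)
open import Data.Sum using (_⊎_; inj₁; inj₂)
open import Relation.Nullary using (Dec; yes; no; ¬_; contradiction)
open import Relation.Nullary.Decidable using (_×-dec_)
open import Relation.Binary.PropositionalEquality
open import Relation.Binary.Construct.Closure.ReflexiveTransitive using (Star; ε; _◅_)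
open import Algebra.Properties.CommutativeSemigroup
  (CommutativeRing.+-commutativeSemigroup xor-∧-commutativeRing)
  using () renaming (interchange to xor-interchange)
open import Algebra.Properties.CommutativeSemigroup
  (CommutativeRing.*-commutativeSemigroup xor-∧-commutativeRing)
  using () renaming (x∙yz≈y∙xz to ∧-leftComm)

private
  variable
    n k p : ℕ

⊕-assoc : (x y z : BitVec n) → (x ⊕ y) ⊕ z ≡ x ⊕ (y ⊕ z)
⊕-assoc = zipWith-assoc xor-assoc

⊕-comm : (x y : BitVec n) → x ⊕ y ≡ y ⊕ x
⊕-comm = zipWith-comm xor-comm

⊕-identityˡ : (x : BitVec n) → zeroV ⊕ x ≡ x
⊕-identityˡ [] = refl
⊕-identityˡ (a ∷ x) = cong (a ∷_) (⊕-identityˡ x)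

⊕-self : (x : BitVec n) → x ⊕ x ≡ zeroV
⊕-self [] = refl
⊕-self (a ∷ x) = cong₂ _∷_ (xor-same a) (⊕-self x)

⊕-cancelˡ : (x y : BitVec n) → x ⊕ (x ⊕ y) ≡ y
⊕-cancelˡ x y = begin
  x ⊕ (x ⊕ y)  ≡⟨ ⊕-assoc x x y ⟨
  (x ⊕ x) ⊕ y  ≡⟨ cong (_⊕ y) (⊕-self x) ⟩
  zeroV ⊕ y    ≡⟨ ⊕-identityˡ y ⟩
  y            ∎
  where open ≡-Reasoning

⊕-cancelʳ : (x y : BitVec n) → x ⊕ (y ⊕ x) ≡ y
⊕-cancelʳ x y = trans (cong (x ⊕_) (⊕-comm y x)) (⊕-cancelˡ x y)

⊕-transfer : (x y u v : BitVec n) → x ⊕ y ≡ u ⊕ v → y ⊕ (x ⊕ u) ≡ v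
⊕-transfer x y u v eq = begin
  y ⊕ (x ⊕ u)  ≡⟨ ⊕-assoc y x u ⟨
  (y ⊕ x) ⊕ u  ≡⟨ cong (_⊕ u) (trans (⊕-comm y x) eq) ⟩
  (u ⊕ v) ⊕ u  ≡⟨ cong (_⊕ u) (⊕-comm u v) ⟩
  (v ⊕ u) ⊕ u  ≡⟨ ⊕-comm (v ⊕ u) u ⟩
  u ⊕ (v ⊕ u)  ≡⟨ ⊕-cancelʳ u v ⟩
  v            ∎
  where open ≡-Reasoning

-- in the form used by lincomb, so lincomb (a ∷ c) (b ∷ B) ≡ a · b ⊕ lincomb c B is refl
infix 25 _·_
_·_ : Bool → BitVec n → BitVec n
a · x = map (a ∧_) x

true·x≡x : (x : BitVec n) → true · x ≡ x
true·x≡x [] = refl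
true·x≡x (a ∷ x) = cong (a ∷_) (true·x≡x x)

false·x≡0 : (x : BitVec n) → false · x ≡ zeroV
false·x≡0 [] = refl
false·x≡0 (a ∷ x) = cong (false ∷_) (false·x≡0 x)

⟨⟩-comm : (s x : BitVec n) → ⟨ s , x ⟩ ≡ ⟨ x , s ⟩
⟨⟩-comm [] [] = refl
⟨⟩-comm (s ∷ ss) (x ∷ xs) = cong₂ _xor_ (∧-comm s x) (⟨⟩-comm ss xs)

⟨0,x⟩≡false : (x : BitVec n) → ⟨ zeroV , x ⟩ ≡ false
⟨0,x⟩≡false [] = refl
⟨0,x⟩≡false (_ ∷ x) = ⟨0,x⟩≡false x

⟨⟩-⊕ʳ : (s x y : BitVec n) → ⟨ s , x ⊕ y ⟩ ≡ ⟨ s , x ⟩ xor ⟨ s , y ⟩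
⟨⟩-⊕ʳ [] [] [] = refl
⟨⟩-⊕ʳ (s ∷ ss) (x ∷ xs) (y ∷ ys) = begin
  (s ∧ (x xor y)) xor ⟨ ss , xs ⊕ ys ⟩
    ≡⟨ cong₂ _xor_ (∧-distribˡ-xor s x y) (⟨⟩-⊕ʳ ss xs ys) ⟩
  ((s ∧ x) xor (s ∧ y)) xor (⟨ ss , xs ⟩ xor ⟨ ss , ys ⟩)
    ≡⟨ xor-interchange (s ∧ x) (s ∧ y) ⟨ ss , xs ⟩ ⟨ ss , ys ⟩ ⟩
  ((s ∧ x) xor ⟨ ss , xs ⟩) xor ((s ∧ y) xor ⟨ ss , ys ⟩) ∎
  where open ≡-Reasoning

⟨⟩-·ʳ : (s : BitVec n) (a : Bool) (x : BitVec n) → ⟨ s , a · x ⟩ ≡ a ∧ ⟨ s , x ⟩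
⟨⟩-·ʳ [] a [] = sym (∧-zeroʳ a)
⟨⟩-·ʳ (s ∷ ss) a (x ∷ xs) = begin
  (s ∧ (a ∧ x)) xor ⟨ ss , a · xs ⟩   ≡⟨ cong₂ _xor_ (∧-leftComm s a x) (⟨⟩-·ʳ ss a xs) ⟩
  (a ∧ (s ∧ x)) xor (a ∧ ⟨ ss , xs ⟩) ≡⟨ ∧-distribˡ-xor a (s ∧ x) ⟨ ss , xs ⟩ ⟨
  a ∧ ((s ∧ x) xor ⟨ ss , xs ⟩)       ∎
  where open ≡-Reasoning

⟨⟩-⊕·ʳ : (s x : BitVec n) (a : Bool) (b : BitVec n) →
         ⟨ s , x ⊕ a · b ⟩ ≡ ⟨ s , x ⟩ xor (a ∧ ⟨ s , b ⟩)
⟨⟩-⊕·ʳ s x a b = trans (⟨⟩-⊕ʳ s x (a · b)) (cong (⟨ s , x ⟩ xor_) (⟨⟩-·ʳ s a b))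

transvection-adjoint : (r s b x : BitVec n) →
                       ⟨ r , x ⊕ ⟨ s , x ⟩ · b ⟩ ≡ ⟨ r ⊕ ⟨ r , b ⟩ · s , x ⟩
transvection-adjoint r s b x = begin
  ⟨ r , x ⊕ ⟨ s , x ⟩ · b ⟩              ≡⟨ ⟨⟩-⊕·ʳ r x ⟨ s , x ⟩ b ⟩
  ⟨ r , x ⟩ xor (⟨ s , x ⟩ ∧ ⟨ r , b ⟩)  ≡⟨ cong₂ _xor_ (⟨⟩-comm r x) swapped ⟩
  ⟨ x , r ⟩ xor (⟨ r , b ⟩ ∧ ⟨ x , s ⟩)  ≡⟨ ⟨⟩-⊕·ʳ x r ⟨ r , b ⟩ s ⟨
  ⟨ x , r ⊕ ⟨ r , b ⟩ · s ⟩              ≡⟨ ⟨⟩-comm x (r ⊕ ⟨ r , b ⟩ · s) ⟩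
  ⟨ r ⊕ ⟨ r , b ⟩ · s , x ⟩              ∎
  where
  open ≡-Reasoning
  swapped : ⟨ s , x ⟩ ∧ ⟨ r , b ⟩ ≡ ⟨ r , b ⟩ ∧ ⟨ x , s ⟩
  swapped = trans (∧-comm ⟨ s , x ⟩ ⟨ r , b ⟩) (cong (⟨ r , b ⟩ ∧_) (⟨⟩-comm s x))

Kernel : List (BitVec n) → BitVec n → Set
Kernel S x = All (λ s → ⟨ s , x ⟩ ≡ false) S

InSpan : Vec (BitVec n) k → BitVec n → Set
InSpan {k = k} B x = Σ (Vec Bool k) λ c → lincomb c B ≡ x

lincomb-replicate-false : (B : Vec (BitVec n) k) → lincomb (replicate k false) B ≡ zeroV
lincomb-replicate-false [] = refl
lincomb-replicate-false (b ∷ B) =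
  trans (cong₂ _⊕_ (false·x≡0 b) (lincomb-replicate-false B)) (⊕-identityˡ zeroV)

LinIndep-tail : (b : BitVec n) (B : Vec (BitVec n) k) → LinIndep (b ∷ B) → LinIndep B
LinIndep-tail b B indep c eq =
  cong Vec.tail (indep (false ∷ c) (trans (cong₂ _⊕_ (false·x≡0 b) eq) (⊕-identityˡ zeroV)))

LinIndep⇒head∉span : (b : BitVec n) (B : Vec (BitVec n) k) → LinIndep (b ∷ B) → ¬ InSpan B b
LinIndep⇒head∉span b B indep (c , eq) =
  contradiction (cong Vec.head (indep (true ∷ c) b⊕b≡0)) λ ()
  where
  b⊕b≡0 : lincomb (true ∷ c) (b ∷ B) ≡ zeroV
  b⊕b≡0 = trans (cong₂ _⊕_ (true·x≡x b) eq) (⊕-self b)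

unitVectors : ∀ n → List (BitVec n)
unitVectors zero = []
unitVectors (suc n) = (true ∷ zeroV) ∷ List.map (false ∷_) (unitVectors n)

length-unitVectors : ∀ n → length (unitVectors n) ≡ n
length-unitVectors zero = refl
length-unitVectors (suc n) = cong suc (trans (length-map _ (unitVectors n)) (length-unitVectors n))

Kernel-unitVectors : (x : BitVec n) → Kernel (unitVectors n) x → x ≡ zeroV
Kernel-unitVectors [] [] = refl
Kernel-unitVectors (a ∷ x) (a≡false ∷ rest) =
  cong₂ _∷_ (trans (sym (first-coordinate a x)) a≡false) (Kernel-unitVectors x (map⁻ rest))
  where
  first-coordinate : ∀ a x → a xor ⟨ zeroV , x ⟩ ≡ a
  first-coordinate a x = trans (cong (a xor_) (⟨0,x⟩≡false x)) (xor-identityʳ a)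

-- One step of Gaussian elimination: a row s with ⟨ s , b ⟩ ≡ true is used as pivot to clear
-- b-coordinates from all other rows.
record Pivoting (b : BitVec n) (S : List (BitVec n)) : Set where
  field
    pivot          : BitVec n
    reduced        : List (BitVec n)
    length-reduced : suc (length reduced) ≡ length S
    Kernel-reduced : ∀ x → Kernel reduced x → Kernel S (x ⊕ ⟨ pivot , x ⟩ · b)

Kernel⊎Pivoting : (b : BitVec n) (S : List (BitVec n)) → Kernel S b ⊎ Pivoting b S
Kernel⊎Pivoting b [] = inj₁ []
Kernel⊎Pivoting b (s ∷ S) with ⟨ s , b ⟩ in sb
... | true = inj₂ record
  { pivot = s
  ; reduced = List.map clear S
  ; length-reduced = cong suc (length-map clear S)
  ; Kernel-reduced = λ x ker → pivot-cleared x ∷ All.map (λ {r} → row-cleared x r) (map⁻ ker)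
  }
  where
  clear : BitVec _ → BitVec _
  clear r = r ⊕ ⟨ r , b ⟩ · s
  row-cleared : ∀ x r → ⟨ clear r , x ⟩ ≡ false → ⟨ r , x ⊕ ⟨ s , x ⟩ · b ⟩ ≡ false
  row-cleared x r = trans (transvection-adjoint r s b x)
  pivot-cleared : ∀ x → ⟨ s , x ⊕ ⟨ s , x ⟩ · b ⟩ ≡ false
  pivot-cleared x = row-cleared x s (begin
    ⟨ s ⊕ ⟨ s , b ⟩ · s , x ⟩ ≡⟨ cong (λ a → ⟨ s ⊕ a · s , x ⟩) sb ⟩
    ⟨ s ⊕ true · s , x ⟩      ≡⟨ cong (λ y → ⟨ s ⊕ y , x ⟩) (true·x≡x s) ⟩
    ⟨ s ⊕ s , x ⟩             ≡⟨ cong ⟨_, x ⟩ (⊕-self s) ⟩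
    ⟨ zeroV , x ⟩             ≡⟨ ⟨0,x⟩≡false x ⟩
    false                     ∎)
    where open ≡-Reasoning
... | false with Kernel⊎Pivoting b S
...   | inj₁ ker = inj₁ (sb ∷ ker)
...   | inj₂ piv = inj₂ record
  { pivot = pivot
  ; reduced = s ∷ reduced
  ; length-reduced = cong suc length-reduced
  ; Kernel-reduced = λ { x (sx ∷ ker) → s-unchanged x sx ∷ Kernel-reduced x ker }
  }
  where
  open Pivoting piv
  s-unchanged : ∀ x → ⟨ s , x ⟩ ≡ false → ⟨ s , x ⊕ ⟨ pivot , x ⟩ · b ⟩ ≡ false
  s-unchanged x sx = begin
    ⟨ s , x ⊕ ⟨ pivot , x ⟩ · b ⟩            ≡⟨ ⟨⟩-⊕·ʳ s x ⟨ pivot , x ⟩ b ⟩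
    ⟨ s , x ⟩ xor (⟨ pivot , x ⟩ ∧ ⟨ s , b ⟩) ≡⟨ cong₂ (λ u v → u xor (⟨ pivot , x ⟩ ∧ v)) sx sb ⟩
    ⟨ pivot , x ⟩ ∧ false                     ≡⟨ ∧-zeroʳ ⟨ pivot , x ⟩ ⟩
    false                                     ∎
    where open ≡-Reasoning

record Equations (B : Vec (BitVec n) k) : Set where
  field
    rows        : List (BitVec n)
    length-rows : length rows + k ≤ n
    Kernel⊆span : ∀ x → Kernel rows x → InSpan B x

equations : (B : Vec (BitVec n) k) → LinIndep B → Equations B
equations {n} [] _ = record
  { rows = unitVectors n
  ; length-rows = ≤-reflexive (trans (+-identityʳ _) (length-unitVectors n))
  ; Kernel⊆span = λ x ker → [] , sym (Kernel-unitVectors x ker)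
  }
equations {n} {suc k} (b ∷ B) indep with equations B (LinIndep-tail b B indep)
... | E with Kernel⊎Pivoting b (Equations.rows E)
...   | inj₁ ker = contradiction (Equations.Kernel⊆span E b ker) (LinIndep⇒head∉span b B indep)
...   | inj₂ piv = record
  { rows = reduced
  ; length-rows = subst (_≤ n) (trans (cong (_+ k) (sym length-reduced)) (sym (+-suc _ k)))
                        (Equations.length-rows E)
  ; Kernel⊆span = λ x ker →
      let (c , eq) = Equations.Kernel⊆span E _ (Kernel-reduced x ker)
      in  ⟨ pivot , x ⟩ ∷ c ,
          trans (cong (⟨ pivot , x ⟩ · b ⊕_) eq) (⊕-cancelʳ (⟨ pivot , x ⟩ · b) x)
  }
  where open Pivoting piv

parities : (S : List (BitVec n)) → BitVec n → BitVec (length S)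
parities S x = map (λ s → ⟨ s , x ⟩) (fromList S)

parities-equal⇒Kernel : (S : List (BitVec n)) (x y : BitVec n) →
                        parities S x ≡ parities S y → Kernel S (x ⊕ y)
parities-equal⇒Kernel [] x y eq = []
parities-equal⇒Kernel (s ∷ S) x y eq =
  trans (⟨⟩-⊕ʳ s x y) (trans (cong (_xor ⟨ s , y ⟩) (proj₁ (∷-injective eq))) (xor-same ⟨ s , y ⟩))
  ∷ parities-equal⇒Kernel S x y (proj₂ (∷-injective eq))

inDom? : (f : Partial n) (x : BitVec n) → Dec (InDom f x)
inDom? f x with f x
... | just b  = yes (b , refl)
... | nothing = no λ ()

-- Subset n is Vec Bool n = BitVec n, so anySubset? is exhaustive search over {0,1}ⁿ.
module _ (f : Partial n) (g : BitVec n → BitVec p) where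

  DefinedFibre : BitVec p → BitVec n → Set
  DefinedFibre v y = InDom f y × g y ≡ v

  definedFibre? : ∀ v y → Dec (DefinedFibre v y)
  definedFibre? v y = inDom? f y ×-dec ≡-dec _≟ᵇ_ (g y) v

  readOff : BitVec p → Bool
  readOff v with anySubset? (definedFibre? v)
  ... | yes (_ , (b , _) , _) = b
  ... | no _                  = false

  readOff-factors : (∀ x y → InDom f x → InDom f y → g x ≡ g y → f x ≡ f y) →
                    ∀ x b → f x ≡ just b → readOff (g x) ≡ b
  readOff-factors respects x b fx with anySubset? (definedFibre? (g x))
  ... | yes (y , (b′ , fy) , gy≡gx) =
          just-injective (trans (sym fy) (trans (respects y x (b′ , fy) (b , fx) gy≡gx) fx))
  ... | no none = contradiction (x , (b , fx) , refl) none

module _ {n t : ℕ} (f : Partial n) (h : BitVec n → BitVec t) (φ : BitVec t → BitVec n → Bool)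
         (realizes : ∀ x y b → f (x ⊕ y) ≡ just b → φ (h x) y ≡ b) where

  goodShift⇒same-value : ∀ {u v} → InDom f u → InDom f v → GoodShift h (u ⊕ v) → f u ≡ f v
  goodShift⇒same-value {u} {v} (b₁ , fu) (b₂ , fv) (x , y , x⊕y≡u⊕v , hx≡hy) =
    trans fu (trans (cong just b₁≡b₂) (sym fv))
    where
    φ-u : φ (h x) (x ⊕ u) ≡ b₁
    φ-u = realizes x (x ⊕ u) b₁ (trans (cong f (⊕-cancelˡ x u)) fu)
    φ-v : φ (h y) (x ⊕ u) ≡ b₂
    φ-v = realizes y (x ⊕ u) b₂ (trans (cong f (⊕-transfer x y u v x⊕y≡u⊕v)) fv)
    b₁≡b₂ : b₁ ≡ b₂
    b₁≡b₂ = trans (sym φ-u) (trans (cong (λ z → φ z (x ⊕ u)) hx≡hy) φ-v)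

  path⇒same-value : ∀ {d} (L : Subspace n d) a {x y} → Star (CosetEdge f h L a) x y → f x ≡ f y
  path⇒same-value L a ε = refl
  path⇒same-value L a ((_ , shift , (dx , _) , (dy , _)) ◅ path) =
    trans (goodShift⇒same-value dx dy shift) (path⇒same-value L a path)

  connected⇒constant-on-cosets : ∀ {d} (L : Subspace n d) → (∀ a → CosetConnected f h L a) →
    ∀ x y → InDom f x → InDom f y → (x ⊕ y) ∈L L → f x ≡ f y
  connected⇒constant-on-cosets L conn x y dx dy x⊕y∈L =
    path⇒same-value L x (conn x x y (dx , x⊕x∈L) (dy , x⊕y∈L))
    where
    x⊕x∈L : (x ⊕ x) ∈L L
    x⊕x∈L = replicate _ false , trans (lincomb-replicate-false (Subspace.basis L)) (sym (⊕-self x))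

corollary18 : (n t : ℕ) (f : Partial n) (h : BitVec n → BitVec t)
    (φ : BitVec t → BitVec n → Bool)
    → (∀ x y b → f (x ⊕ y) ≡ just b → φ (h x) y ≡ b)
    → (L : Subspace n (n ∸ t))
    → (∀ a → CosetConnected f h L a)
    → NADT⊕≤ f t
corollary18 n t f h φ realizes L conn =
  length rows , rows≤t , fromList rows , readOff f (parities rows) , readOff-factors f (parities rows) respects
  where
  open Equations (equations (Subspace.basis L) (Subspace.indep L))
  rows≤t : length rows ≤ t
  rows≤t = +-cancelʳ-≤ (n ∸ t) (length rows) t (≤-trans length-rows (m≤n+m∸n n t))
  respects : ∀ x y → InDom f x → InDom f y → parities rows x ≡ parities rows y → f x ≡ f y
  respects x y dx dy eq = connected⇒constant-on-cosets f h φ realizes L conn x y dx dy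
    (Kernel⊆span (x ⊕ y) (parities-equal⇒Kernel rows x y eq))
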